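{- Let $k\ge2$ and $b\ge1$ be integers, $g=b(k+1)$, and $m\ge0$ an integer. Suppose $Y(g,k)$ contains a node of the form $\left[\frac{s(k-1)}{b^m},\frac{t(k-1)}{b^{m+1}}\right]$ with $s,t$ integers. Then: (i) every edge leaving this node has a label of the form $\left(\frac{s(k-1)}{b^{m-1}}+u,\ \frac{(t-b^2s)(k-1)}{b^{m+1}}+ku\right)$ for some integer $u$; (ii) the edge with this label leaving the node terminates at the node $\left[\frac{t(k-1)}{b^{m+1}},\ \frac{(t-b^2s+b^{m+1}u)(k-1)}{b^{m+2}}\right]$; (iii) $t\equiv0\pmod b$.
   Context: For integers $2\le k<g$, the labeled directed graph $H(g,k)$ has a distinguished starting node $[[0,0]]$ and other nodes labeled by pairs $[R,r]$ of integers with $0\le R,r\le k-1$ (the node $[0,0]$ is distinct from the starting node). For a node $[P,p]$ (the starting node treated as $[0,0]$ here) there is an edge labeled $(A,a)$ from $[P,p]$ to $[R,r]$ whenever $0\le A,a\le g-1$ are integers, $0\le R,r\le k-1$, $ka+p=A+rg$ and $kA+R=a+Pg$; edges leaving the starting node additionally require $A\ne0\ne a$; no edge enters the starting node. $H(g,k)$ consists of the starting node and all nodes reachable from it. An even pivot node is a node $[a,a]$; an odd pivot node is a node $[r,s]$ with an edge to $[s,r]$; the starting node is not a pivot node. $Y(g,k)$ is obtained from $H(g,k)$ by deleting every node that is not a pivot node and from which no pivot node is reachable, with incident edges. -}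

module Defs where

open import Data.Nat using (ℕ; zero; suc; _+_; _*_; _<_)
open import Data.Product using (_×_; _,_; ∃; Σ)
open import Data.Sum using (_⊎_)
open import Relation.Binary.PropositionalEquality using (_≡_; _≢_)
open import Relation.Binary.Construct.Closure.ReflexiveTransitive using (Star)

-- Nodes of H(g,k): the distinguished starting node [[0,0]], and pair nodes [R,r].
-- (Bounds 0 ≤ R,r ≤ k-1 are imposed by the edge relation: every node reached
-- by an edge satisfies them.)
data Node : Set where
  start : Node
  node  : ℕ → ℕ → Node

fstC : Node → ℕ
fstC start      = 0
fstC (node P p) = P

sndC : Node → ℕ
sndC start      = 0
sndC (node P p) = p

record EdgeCond (g k P p A a R r : ℕ) : Set where
  field
    A<g : A < g
    a<g : a < g
    R<k : R < k
    r<k : r < k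
    eq₁ : k * a + p ≡ A + r * g
    eq₂ : k * A + R ≡ a + P * g

data Edge (g k : ℕ) : Node → ℕ × ℕ → Node → Set where
  edgeStart : ∀ {A a R r} → EdgeCond g k 0 0 A a R r → A ≢ 0 → a ≢ 0 →
              Edge g k start (A , a) (node R r)
  edgeNode  : ∀ {P p A a R r} → EdgeCond g k P p A a R r →
              Edge g k (node P p) (A , a) (node R r)

Step : (g k : ℕ) → Node → Node → Set
Step g k v w = ∃ λ l → Edge g k v l w

Reach : (g k : ℕ) → Node → Node → Set
Reach g k = Star (Step g k)

InH : (g k : ℕ) → Node → Set
InH g k v = Reach g k start v

data Pivot (g k : ℕ) : Node → Set where
  evenPivot : ∀ {a} → Pivot g k (node a a)
  oddPivot  : ∀ {r s} l → Edge g k (node r s) l (node s r) → Pivot g k (node r s)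

IsPivotInH : (g k : ℕ) → Node → Set
IsPivotInH g k v = InH g k v × Pivot g k v

InY : (g k : ℕ) → Node → Set
InY g k v = InH g k v × (Pivot g k v ⊎ ∃ λ w → Reach g k v w × Pivot g k w)

YEdge : (g k : ℕ) → Node → ℕ × ℕ → Node → Set
YEdge g k v l w = InY g k v × InY g k w × Edge g k v l w

module Submission where

-- Fix k and b, let g = b(k+1) and N = k - 1.  The proof rests on two facts
-- about a single edge (A,a) : [P,p] → [R′,r′] of H(g,k) whose source satisfies
-- p < k (true for every node reached by an edge).
--   * Shift: R′ = p, because both sides of the edge equations agree modulo k+1.
--   * Shape: with the offset u = A - bP one has  a = u + b r′  and
--     b(P + r′) = p + N u  (the "balance" equation).
-- The balance equation shows that the divisibility property
--     Descent(P,p):  for all m,  N ∣ b^m P  and  N ∣ b^(m+1) p  imply  N ∣ b^m p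
-- passes from the target of an edge back to its source.  It holds at even
-- pivots trivially and at odd pivots by the balance equation, hence at every
-- node of Y(g,k).  Applied to the node [s(k-1)/b^m, t(k-1)/b^(m+1)] it gives
-- b ∣ t (part (iii)); parts (i) and (ii) are linear consequences of the shift
-- and shape equations.

open import Defs
open import Data.Nat using (ℕ; suc; _≤_; _∸_)
open import Data.Integer using (ℤ; +_; _+_; _-_; _*_; _^_)
open import Data.Integer.Divisibility using (_∣_)
open import Data.Product using (_×_; _,_; Σ)
open import Relation.Binary.PropositionalEquality using (_≡_)

open import Data.Integer using (1ℤ; NonZero)
open import Data.Integer.Divisibility.Signed using (divides; ∣-refl; ∣⇒∣ᵤ;
  ∣m∣n⇒∣m+n; ∣m∣n⇒∣m-n; ∣m⇒∣m*n; ∣n⇒∣m*n)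
  renaming (_∣_ to _∣ₛ_)
import Data.Integer.Properties as ℤP
open import Data.Integer.Tactic.RingSolver using (solve)
import Data.Nat as ℕ
open import Data.Nat.DivMod using (_%_; m<n⇒m%n≡m; [m+kn]%n≡m%n)
open import Data.Nat.Properties using (m<n⇒m<1+n)
import Data.Nat.Tactic.RingSolver as ℕRing
open import Data.List using (_∷_; [])
open import Data.Sum using (inj₁; inj₂)
open import Data.Unit using (⊤; tt)
open import Relation.Binary.Construct.Closure.ReflexiveTransitive using (ε; _◅_)
open import Relation.Binary.PropositionalEquality
  using (refl; sym; trans; cong; cong₂; subst; module ≡-Reasoning)

open ≡-Reasoning

record EdgeShape (k b P p A a r′ : ℤ) : Set where
  field
    offset  : ℤ
    source  : A ≡ b * P + offset
    target  : a ≡ offset + b * r′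
    balance : b * (P + r′) ≡ p + (k - 1ℤ) * offset

-- The two edge equations determine the shape, with offset u = A - bP.  The
-- label a is found after cancelling the factor k + 1, the balance equation
-- then follows from the first edge equation.
edge-shape : ∀ (k b P p A a r′ : ℤ) .{{_ : NonZero (1ℤ + k)}} →
  k * a + p ≡ A + r′ * (b * (1ℤ + k)) →
  k * A + p ≡ a + P * (b * (1ℤ + k)) →
  EdgeShape k b P p A a r′
edge-shape k b P p A a r′ e₁ e₂ = record
  { offset = A - b * P ; source = source ; target = target ; balance = balance }
  where
  source : A ≡ b * P + (A - b * P)
  source = solve (A ∷ b ∷ P ∷ [])

  scaled-target : (1ℤ + k) * a ≡ (1ℤ + k) * ((A - b * P) + b * r′)
  scaled-target = begin
    (1ℤ + k) * a
      ≡⟨ solve (k ∷ a ∷ p ∷ A ∷ []) ⟩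
    (k * a + p) - (k * A + p) + k * A + a
      ≡⟨ cong₂ (λ x y → x - y + k * A + a) e₁ e₂ ⟩
    (A + r′ * (b * (1ℤ + k))) - (a + P * (b * (1ℤ + k))) + k * A + a
      ≡⟨ solve (k ∷ b ∷ P ∷ A ∷ a ∷ r′ ∷ []) ⟩
    (1ℤ + k) * ((A - b * P) + b * r′) ∎

  target : a ≡ (A - b * P) + b * r′
  target = ℤP.*-cancelˡ-≡ (1ℤ + k) a _ scaled-target

  balance : b * (P + r′) ≡ p + (k - 1ℤ) * (A - b * P)
  balance = begin
    b * (P + r′)
      ≡⟨ solve (k ∷ b ∷ P ∷ A ∷ r′ ∷ []) ⟩
    (A + r′ * (b * (1ℤ + k))) - k * ((A - b * P) + b * r′) + (k - 1ℤ) * (A - b * P)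
      ≡⟨ cong₂ (λ x y → x - k * y + (k - 1ℤ) * (A - b * P)) (sym e₁) (sym target) ⟩
    (k * a + p) - k * a + (k - 1ℤ) * (A - b * P)
      ≡⟨ solve (k ∷ b ∷ P ∷ p ∷ A ∷ a ∷ []) ⟩
    p + (k - 1ℤ) * (A - b * P) ∎

-- Parts (i) and (ii) at the level of integers: if the source [R,r] of an edge
-- of the given shape satisfies R c = s N and r (b c) = t N (where c stands for
-- b^m and N = k - 1), then its labels and its target have the stated form.
label-identities : ∀ {k b R r A a r′ s t} (c : ℤ) (shape : EdgeShape k b R r A a r′) →
  let u = EdgeShape.offset shape ; N = k - 1ℤ in
  R * c ≡ s * N → r * (b * c) ≡ t * N →
  (A * c ≡ s * N * b + u * c) ×
  (a * (b * c) ≡ (t - b * (b * 1ℤ) * s) * N + k * u * (b * c)) ×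
  (r′ * (b * (b * c)) ≡ (t - b * (b * 1ℤ) * s + (b * c) * u) * N)
label-identities {k} {b} {R} {r} {A} {a} {r′} {s} {t} c
  record { offset = u ; source = source ; target = target ; balance = balance } hR hr =
  source-label , target-label , target-node
  where

  source-label : A * c ≡ s * (k - 1ℤ) * b + u * c
  source-label = begin
    A * c                      ≡⟨ cong (_* c) source ⟩
    (b * R + u) * c            ≡⟨ solve (b ∷ R ∷ u ∷ c ∷ []) ⟩
    b * (R * c) + u * c        ≡⟨ cong (λ x → b * x + u * c) hR ⟩
    b * (s * (k - 1ℤ)) + u * c ≡⟨ solve (k ∷ b ∷ s ∷ u ∷ c ∷ []) ⟩
    s * (k - 1ℤ) * b + u * c   ∎

  target-node : r′ * (b * (b * c)) ≡ (t - b * (b * 1ℤ) * s + (b * c) * u) * (k - 1ℤ)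
  target-node = begin
    r′ * (b * (b * c))
      ≡⟨ solve (b ∷ R ∷ r′ ∷ c ∷ []) ⟩
    b * (R + r′) * (b * c) - b * b * (R * c)
      ≡⟨ cong₂ (λ x y → x * (b * c) - b * b * y) balance hR ⟩
    (r + (k - 1ℤ) * u) * (b * c) - b * b * (s * (k - 1ℤ))
      ≡⟨ solve (k ∷ b ∷ r ∷ u ∷ c ∷ s ∷ []) ⟩
    r * (b * c) + (k - 1ℤ) * u * (b * c) - b * b * (s * (k - 1ℤ))
      ≡⟨ cong (λ x → x + (k - 1ℤ) * u * (b * c) - b * b * (s * (k - 1ℤ))) hr ⟩
    t * (k - 1ℤ) + (k - 1ℤ) * u * (b * c) - b * b * (s * (k - 1ℤ))
      ≡⟨ solve (k ∷ b ∷ t ∷ u ∷ c ∷ s ∷ []) ⟩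
    (t - b * (b * 1ℤ) * s + (b * c) * u) * (k - 1ℤ) ∎

  target-label : a * (b * c) ≡ (t - b * (b * 1ℤ) * s) * (k - 1ℤ) + k * u * (b * c)
  target-label = begin
    a * (b * c)
      ≡⟨ cong (_* (b * c)) target ⟩
    (u + b * r′) * (b * c)
      ≡⟨ solve (u ∷ b ∷ r′ ∷ c ∷ []) ⟩
    u * (b * c) + r′ * (b * (b * c))
      ≡⟨ cong (λ x → u * (b * c) + x) target-node ⟩
    u * (b * c) + (t - b * (b * 1ℤ) * s + (b * c) * u) * (k - 1ℤ)
      ≡⟨ solve (k ∷ b ∷ t ∷ u ∷ c ∷ s ∷ []) ⟩
    (t - b * (b * 1ℤ) * s) * (k - 1ℤ) + k * u * (b * c) ∎

Descent : (N b P p : ℤ) → Set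
Descent N b P p = ∀ m → N ∣ₛ b ^ m * P → N ∣ₛ b ^ suc m * p → N ∣ₛ b ^ m * p

balance-transfer : ∀ {N b P p r′ u} (c : ℤ) → b * (P + r′) ≡ p + N * u →
  N ∣ₛ c * P → N ∣ₛ b * c * p → (N ∣ₛ b * (b * c) * r′ → N ∣ₛ b * c * r′) →
  N ∣ₛ c * p
balance-transfer {N} {b} {P} {p} {r′} {u} c bal N∣cP N∣bcp descend =
  subst (N ∣ₛ_) (sym source-expansion)
    (∣m∣n⇒∣m-n (∣m∣n⇒∣m+n (∣n⇒∣m*n b N∣cP) (descend N∣bbcr′)) (∣m⇒∣m*n _ ∣-refl))
  where
  target-expansion : b * (b * c) * r′ ≡ b * c * p + N * (u * (b * c)) - b * (b * (c * P))
  target-expansion = begin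
    b * (b * c) * r′                         ≡⟨ solve (b ∷ c ∷ P ∷ r′ ∷ []) ⟩
    b * c * (b * (P + r′)) - b * (b * (c * P)) ≡⟨ cong (λ x → b * c * x - b * (b * (c * P))) bal ⟩
    b * c * (p + N * u) - b * (b * (c * P))  ≡⟨ solve (b ∷ c ∷ p ∷ N ∷ u ∷ P ∷ []) ⟩
    b * c * p + N * (u * (b * c)) - b * (b * (c * P)) ∎

  N∣bbcr′ : N ∣ₛ b * (b * c) * r′
  N∣bbcr′ = subst (N ∣ₛ_) (sym target-expansion)
    (∣m∣n⇒∣m-n (∣m∣n⇒∣m+n N∣bcp (∣m⇒∣m*n _ ∣-refl)) (∣n⇒∣m*n b (∣n⇒∣m*n b N∣cP)))

  source-expansion : c * p ≡ b * (c * P) + b * c * r′ - N * (u * c)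
  source-expansion = begin
    c * p                       ≡⟨ solve (c ∷ p ∷ N ∷ u ∷ []) ⟩
    (p + N * u) * c - N * (u * c) ≡⟨ cong (λ x → x * c - N * (u * c)) (sym bal) ⟩
    b * (P + r′) * c - N * (u * c) ≡⟨ solve (b ∷ P ∷ r′ ∷ c ∷ N ∷ u ∷ []) ⟩
    b * (c * P) + b * c * r′ - N * (u * c) ∎

descent-step : ∀ {N b P p r′ u} → b * (P + r′) ≡ p + N * u →
  Descent N b p r′ → Descent N b P p
descent-step {b = b} {r′ = r′} bal descent m N∣P N∣p =
  balance-transfer {b = b} {r′ = r′} (b ^ m) bal N∣P N∣p (descent (suc m) N∣p)

-- An odd pivot [r,s] (with an edge to [s,r]) satisfies Descent: its balance
-- equation b(r + r) = s + N u expresses b^m s through b^m r.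
odd-pivot-descent : ∀ {N b r s u} → b * (r + r) ≡ s + N * u → Descent N b r s
odd-pivot-descent {N} {b} {r} {s} {u} bal m N∣r _ =
  subst (N ∣ₛ_) (sym (expansion (b ^ m)))
    (∣m∣n⇒∣m-n (∣m∣n⇒∣m+n (∣n⇒∣m*n b N∣r) (∣n⇒∣m*n b N∣r)) (∣m⇒∣m*n _ ∣-refl))
  where
  expansion : (c : ℤ) → c * s ≡ b * (c * r) + b * (c * r) - N * (u * c)
  expansion c = begin
    c * s                         ≡⟨ solve (c ∷ s ∷ N ∷ u ∷ []) ⟩
    (s + N * u) * c - N * (u * c) ≡⟨ cong (λ x → x * c - N * (u * c)) (sym bal) ⟩
    b * (r + r) * c - N * (u * c) ≡⟨ solve (b ∷ r ∷ c ∷ N ∷ u ∷ []) ⟩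
    b * (c * r) + b * (c * r) - N * (u * c) ∎

divides-quotient : ∀ {N b c r t} .{{_ : NonZero N}} →
  N ∣ₛ c * r → r * (b * c) ≡ t * N → b ∣ t
divides-quotient {N} {b} {c} {r} {t} (divides q cr≡qN) hr =
  ∣⇒∣ᵤ (divides q (ℤP.*-cancelʳ-≡ t (q * b) N tN≡qbN))
  where
  tN≡qbN : t * N ≡ q * b * N
  tN≡qbN = begin
    t * N       ≡⟨ sym hr ⟩
    r * (b * c) ≡⟨ solve (r ∷ b ∷ c ∷ []) ⟩
    b * (c * r) ≡⟨ cong (b *_) cr≡qN ⟩
    b * (q * N) ≡⟨ solve (b ∷ q ∷ N ∷ []) ⟩
    q * b * N   ∎

congruent-residues : ∀ n .{{_ : ℕ.NonZero n}} {x y q q′ : ℕ} →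
  x ℕ.< n → y ℕ.< n → x ℕ.+ q ℕ.* n ≡ y ℕ.+ q′ ℕ.* n → x ≡ y
congruent-residues n {x} {y} {q} {q′} x<n y<n eq = begin
  x                  ≡⟨ sym (m<n⇒m%n≡m x<n) ⟩
  x % n              ≡⟨ sym ([m+kn]%n≡m%n x q n) ⟩
  (x ℕ.+ q ℕ.* n) % n  ≡⟨ cong (_% n) eq ⟩
  (y ℕ.+ q′ ℕ.* n) % n ≡⟨ [m+kn]%n≡m%n y q′ n ⟩
  y % n              ≡⟨ m<n⇒m%n≡m y<n ⟩
  y                  ∎

-- Shift: an edge out of [P,p] with p < k enters a node whose first coordinate
-- is p, since adding the edge equations shows R′ ≡ p modulo k + 1.
edge-shift : ∀ {k b P p A a R′ r′} → EdgeCond (b ℕ.* suc k) k P p A a R′ r′ →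
  p ℕ.< k → R′ ≡ p
edge-shift {k} {b} {P} {p} {A} {a} {R′} {r′} cond p<k =
  congruent-residues (suc k) {q = A ℕ.+ r′ ℕ.* b} {q′ = a ℕ.+ P ℕ.* b}
    (m<n⇒m<1+n R<k) (m<n⇒m<1+n p<k) residues
  where
  open EdgeCond cond
  residues : R′ ℕ.+ (A ℕ.+ r′ ℕ.* b) ℕ.* suc k ≡ p ℕ.+ (a ℕ.+ P ℕ.* b) ℕ.* suc k
  residues = begin
    R′ ℕ.+ (A ℕ.+ r′ ℕ.* b) ℕ.* suc k
      ≡⟨ ℕRing.solve (R′ ∷ A ∷ r′ ∷ b ∷ k ∷ []) ⟩
    (A ℕ.+ r′ ℕ.* (b ℕ.* suc k)) ℕ.+ (k ℕ.* A ℕ.+ R′)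
      ≡⟨ cong₂ ℕ._+_ (sym eq₁) eq₂ ⟩
    (k ℕ.* a ℕ.+ p) ℕ.+ (a ℕ.+ P ℕ.* (b ℕ.* suc k))
      ≡⟨ ℕRing.solve (k ∷ a ∷ p ∷ P ∷ b ∷ []) ⟩
    p ℕ.+ (a ℕ.+ P ℕ.* b) ℕ.* suc k ∎

edge-equation-ℤ : ∀ k b x y z w →
  k ℕ.* x ℕ.+ y ≡ z ℕ.+ w ℕ.* (b ℕ.* suc k) →
  + k * + x + + y ≡ + z + + w * (+ b * (1ℤ + + k))
edge-equation-ℤ k b x y z w eq = begin
  + k * + x + + y               ≡⟨ cong (λ i → i + + y) (sym (ℤP.pos-* k x)) ⟩
  + (k ℕ.* x) + + y             ≡⟨ sym (ℤP.pos-+ (k ℕ.* x) y) ⟩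
  + (k ℕ.* x ℕ.+ y)             ≡⟨ cong +_ eq ⟩
  + (z ℕ.+ w ℕ.* (b ℕ.* suc k)) ≡⟨ ℤP.pos-+ z (w ℕ.* (b ℕ.* suc k)) ⟩
  + z + + (w ℕ.* (b ℕ.* suc k)) ≡⟨ cong (λ i → + z + i) (ℤP.pos-* w (b ℕ.* suc k)) ⟩
  + z + + w * + (b ℕ.* suc k)   ≡⟨ cong (λ i → + z + + w * i) (ℤP.pos-* b (suc k)) ⟩
  + z + + w * (+ b * + suc k)   ∎

edge-data : ∀ {k b P p A a R′ r′} → p ℕ.< k →
  EdgeCond (b ℕ.* suc k) k P p A a R′ r′ →
  R′ ≡ p × EdgeShape (+ k) (+ b) (+ P) (+ p) (+ A) (+ a) (+ r′)
edge-data {k} {b} {P} {p} {A} {a} {r′ = r′} p<k cond with edge-shift {b = b} cond p<k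
... | refl = refl , edge-shape (+ k) (+ b) (+ P) (+ p) (+ A) (+ a) (+ r′)
                      (edge-equation-ℤ k b a p A r′ (EdgeCond.eq₁ cond))
                      (edge-equation-ℤ k b A p a P (EdgeCond.eq₂ cond))

module _ (k b : ℕ) where

  private
    g : ℕ
    g = b ℕ.* suc k

  Bounded : Node → Set
  Bounded start      = ⊤
  Bounded (node P p) = p ℕ.< k

  step-bounded : ∀ {v w} → Step g k v w → Bounded w
  step-bounded (_ , edgeStart cond _ _) = EdgeCond.r<k cond
  step-bounded (_ , edgeNode cond)      = EdgeCond.r<k cond

  reach-bounded : ∀ {v w} → Reach g k v w → Bounded v → Bounded w
  reach-bounded ε             bv = bv
  reach-bounded (step ◅ path) _  = reach-bounded path (step-bounded step)

  NodeDescent : Node → Set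
  NodeDescent start      = ⊤
  NodeDescent (node P p) = Descent (+ k - 1ℤ) (+ b) (+ P) (+ p)

  step-descent : ∀ {v w} → Bounded v → Step g k v w → NodeDescent w → NodeDescent v
  step-descent {start}    _   _                 _ = tt
  step-descent {node P p} p<k (_ , edgeNode cond) descent with edge-data {b = b} p<k cond
  ... | refl , shape = descent-step (EdgeShape.balance shape) descent

  reach-descent : ∀ {v w} → Reach g k v w → Bounded v → NodeDescent w → NodeDescent v
  reach-descent ε              _  descent = descent
  reach-descent (step ◅ path) bv descent =
    step-descent bv step (reach-descent path (step-bounded step) descent)

  -- Pivot nodes satisfy Descent; an odd pivot [r,s] has s < k because s is
  -- the first coordinate of the target of its edge.
  pivot-descent : ∀ {v} → Pivot g k v → NodeDescent v
  pivot-descent evenPivot                       _ N∣a _ = N∣a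
  pivot-descent (oddPivot _ (edgeNode cond)) with edge-data {b = b} (EdgeCond.R<k cond) cond
  ... | _ , shape = odd-pivot-descent (EdgeShape.balance shape)

  Y-descent : ∀ {v} → InY g k v → NodeDescent v
  Y-descent (_   , inj₁ pivot)               = pivot-descent pivot
  Y-descent (inH , inj₂ (_ , path , pivot)) =
    reach-descent path (reach-bounded inH tt) (pivot-descent pivot)

lemma2 : (k b m : ℕ) → 2 ≤ k → 1 ≤ b →
  (R r : ℕ) (s t : ℤ) →
  InY (b Data.Nat.* suc k) k (node R r) →
  -- R = s(k-1)/b^m  and  r = t(k-1)/b^(m+1)  (denominators cleared)
  (+ R) * (+ b) ^ m ≡ s * (+ (k ∸ 1)) →
  (+ r) * (+ b) ^ suc m ≡ t * (+ (k ∸ 1)) →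
  ((A a : ℕ) (w : Node) → YEdge (b Data.Nat.* suc k) k (node R r) (A , a) w →
    Σ ℤ λ u →
      -- (i) A = s(k-1)/b^(m-1) + u ,  a = (t - b^2 s)(k-1)/b^(m+1) + k u
      ((+ A) * (+ b) ^ m ≡ s * (+ (k ∸ 1)) * (+ b) + u * (+ b) ^ m) ×
      ((+ a) * (+ b) ^ suc m ≡ (t - (+ b) ^ 2 * s) * (+ (k ∸ 1)) + (+ k) * u * (+ b) ^ suc m) ×
      -- (ii) w = [ t(k-1)/b^(m+1) , (t - b^2 s + b^(m+1) u)(k-1)/b^(m+2) ]
      Σ ℕ λ R′ → Σ ℕ λ r′ → (w ≡ node R′ r′) ×
        ((+ R′) * (+ b) ^ suc m ≡ t * (+ (k ∸ 1))) ×
        ((+ r′) * (+ b) ^ suc (suc m) ≡ (t - (+ b) ^ 2 * s + (+ b) ^ suc m * u) * (+ (k ∸ 1)))) ×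
  -- (iii) t ≡ 0 (mod b)
  (+ b) ∣ t
lemma2 ℕ.zero        _ _ ()
lemma2 (suc ℕ.zero)  _ _ (ℕ.s≤s ())
lemma2 (suc (suc j)) b m _ _ R r s t inY@(inH , _) hR hr =
  (λ { A a _ (_ , _ , edgeNode {R = R′} {r = r′} cond) →
    let (shift , shape) = edge-data r<k cond
        (source-label , target-label , target-node) = label-identities {s = s} {t = t} ((+ b) ^ m) shape hR hr
    in EdgeShape.offset shape , source-label , target-label , R′ , r′ , refl ,
       subst (λ x → + x * (+ b) ^ suc m ≡ t * + suc j) (sym shift) hr , target-node }) ,
  divides-quotient {b = + b} {c = (+ b) ^ m} {r = + r} {t = t}
    (Y-descent (suc (suc j)) b inY m (divides s (trans (ℤP.*-comm ((+ b) ^ m) (+ R)) hR))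
                                     (divides t (trans (ℤP.*-comm ((+ b) ^ suc m) (+ r)) hr)))
    hr
  where
  r<k : r ℕ.< suc (suc j)
  r<k = reach-bounded (suc (suc j)) b inH tt
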